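{- Let $G=(V,E)$ be a connected simple bridgeless triangle-free cubic graph and let $\lambda$ be a valid labeling of $\mathfrak{L}_2(G)$. Then the edge-induced subgraph of $\mathfrak{L}_2(G)$ on the set of open edges $\{e\in E(\mathfrak{L}_2(G)) : \lambda_e=1\}$ is a disjoint union of cycles.
   Context: For a simple graph $H$, the line graph $\mathcal{L}(H)$ has vertex set $E(H)$, two edges adjacent iff they share exactly one endpoint. For each triangle $T$ of $\mathcal{L}(G)$, its three edges span a triangle $\mathcal{L}(T)$ in $\mathcal{L}(\mathcal{L}(G))$. The graph $\mathfrak{L}_2(G)$ is $\mathcal{L}(\mathcal{L}(G))$ with all edges of all such triangles $\mathcal{L}(T)$ deleted (vertex set unchanged). Reduced cliques: for each edge $x\in E$ (a vertex of $\mathcal{L}(G)$), the four edges of $\mathcal{L}(G)$ incident to $x$ are pairwise adjacent in $\mathcal{L}(\mathcal{L}(G))$, forming a clique $K_4$; the reduced clique $\mathbb{X}_x$ is the subgraph of $\mathfrak{L}_2(G)$ formed by this $K_4$ minus the deleted edges. A labeling is a map $\lambda:E(\mathfrak{L}_2(G))\to\{0,1\}$, $e\mapsto\lambda_e$ ($1$ = open, $0$ = closed); it is valid if for every reduced clique $\mathbb{X}$ and every vertex $v$ of $\mathbb{X}$ there are vertices $w,u$ of $\mathbb{X}$ other than $v$ with $\langle v,w\rangle,\langle v,u\rangle$ edges of $\mathbb{X}$ and $\lambda_{\langle v,w\rangle}=1-\lambda_{\langle v,u\rangle}$. -}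

module Defs where

open import Data.Nat using (ℕ; _≥_)
open import Data.Fin using (Fin)
open import Data.Bool using (Bool; true; false; T; not)
open import Data.Product using (Σ; Σ-syntax; ∃; ∃-syntax; _×_; _,_; proj₁; proj₂)
open import Data.Sum using (_⊎_)
open import Data.Empty using (⊥)
open import Relation.Nullary using (¬_)
open import Relation.Binary.PropositionalEquality using (_≡_)
open import Data.List using (List; []; _∷_; _++_; [_]; zip; length; filterᵇ; allFin)
open import Data.List.Relation.Unary.All using (All)
open import Data.List.Relation.Unary.Any using (Any)
open import Data.List.Relation.Unary.AllPairs using (AllPairs)

record SimpleGraph (n : ℕ) : Set where
  field
    adj    : Fin n → Fin n → Bool
    sym    : ∀ u v → adj u v ≡ adj v u
    irrefl : ∀ u → adj u u ≡ false

module _ {n : ℕ} (G : SimpleGraph n) where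
  open SimpleGraph G

  GAdj : Fin n → Fin n → Set
  GAdj u v = T (adj u v)

  degree : Fin n → ℕ
  degree v = length (filterᵇ (adj v) (allFin n))

  Cubic : Set
  Cubic = ∀ v → degree v ≡ 3

  TriangleFree : Set
  TriangleFree = ∀ u v w → GAdj u v → GAdj v w → GAdj u w → ⊥

  data Reach (R : Fin n → Fin n → Set) : Fin n → Fin n → Set where
    here : ∀ {u} → Reach R u u
    step : ∀ {u v w} → R u v → Reach R v w → Reach R u w

  Connected : Set
  Connected = ∀ u v → Reach GAdj u v

  AdjMinus : Fin n → Fin n → Fin n → Fin n → Set
  AdjMinus u v a b = GAdj a b × ¬ ((a ≡ u × b ≡ v) ⊎ (a ≡ v × b ≡ u))

  IsBridge : Fin n → Fin n → Set
  IsBridge u v = GAdj u v × ¬ Reach (AdjMinus u v) u v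

  Bridgeless : Set
  Bridgeless = ∀ u v → ¬ IsBridge u v

-- Graphs whose vertices are given by representatives modulo an
-- equivalence _≈_ (used because edges are unordered pairs).

record Gph : Set₁ where
  field
    V   : Set
    _≈_ : V → V → Set
    Adj : V → V → Set

module _ (H : Gph) where
  open Gph H

  -- an edge of H, represented by an oriented pair
  Edge : Set
  Edge = Σ (V × V) λ ab → Adj (proj₁ ab) (proj₂ ab)

  src tgt : Edge → V
  src e = proj₁ (proj₁ e)
  tgt e = proj₂ (proj₁ e)

  Ends : Edge → V → Set
  Ends e w = w ≈ src e ⊎ w ≈ tgt e

  SameEdge : Edge → Edge → Set
  SameEdge e f = (src e ≈ src f × tgt e ≈ tgt f) ⊎ (src e ≈ tgt f × tgt e ≈ src f)

  ShareExactlyOne : Edge → Edge → Set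
  ShareExactlyOne e f =
    Σ[ w ∈ V ] (Ends e w × Ends f w × (∀ w′ → Ends e w′ → Ends f w′ → w′ ≈ w))

  Line : Gph
  Line = record { V = Edge ; _≈_ = SameEdge ; Adj = ShareExactlyOne }

  Triangle : V → V → V → Set
  Triangle x y z = Adj x y × Adj y z × Adj x z

  InTriangle : V → V → V → Edge → Set
  InTriangle x y z e = ∀ w → Ends e w → (w ≈ x ⊎ w ≈ y ⊎ w ≈ z)

toGph : ∀ {n} → SimpleGraph n → Gph
toGph {n} G = record { V = Fin n ; _≈_ = _≡_ ; Adj = GAdj G }

module _ {n : ℕ} (G : SimpleGraph n) where

  LG : Gph
  LG = Line (toGph G)

  LLG : Gph
  LLG = Line LG

  -- vertices of L(G) (= edges of G) and of L(L(G)) (= edges of L(G))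
  V₁ : Set
  V₁ = Gph.V LG

  V₂ : Set
  V₂ = Gph.V LLG

  _≈₂_ : V₂ → V₂ → Set
  _≈₂_ = Gph._≈_ LLG

  -- the edge {p,q} of L(L(G)) lies in 𝓛(T) for some triangle T of L(G)
  Deleted : V₂ → V₂ → Set
  Deleted p q = Σ[ x ∈ V₁ ] Σ[ y ∈ V₁ ] Σ[ z ∈ V₁ ]
    (Triangle LG x y z × InTriangle LG x y z p × InTriangle LG x y z q)

  Adj₂ : V₂ → V₂ → Set
  Adj₂ p q = Gph.Adj LLG p q × ¬ Deleted p q

  -- p is a vertex of the reduced clique 𝕏_x (p is an edge of L(G) at x)
  InX : V₁ → V₂ → Set
  InX x p = Ends LG p x

  EdgeX : V₁ → V₂ → V₂ → Set
  EdgeX x p q = InX x p × InX x q × Adj₂ p q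

  -- a labeling of the edges of 𝔏₂(G): a 0/1 value (true = open = 1)
  -- on each edge, independent of the chosen representatives
  record Labeling : Set where
    field
      lab     : V₂ → V₂ → Bool
      lab-sym : ∀ p q → Adj₂ p q → lab p q ≡ lab q p
      lab-rep : ∀ p q p′ q′ → Adj₂ p q → p ≈₂ p′ → q ≈₂ q′ → lab p q ≡ lab p′ q′

  Valid : Labeling → Set
  Valid λ′ = ∀ (x : V₁) (v : V₂) → InX x v →
    Σ[ w ∈ V₂ ] Σ[ u ∈ V₂ ]
      (¬ w ≈₂ v × ¬ u ≈₂ v × EdgeX x v w × EdgeX x v u
       × lab v w ≡ not (lab v u))
    where open Labeling λ′

  OpenEdge : Labeling → V₂ → V₂ → Set
  OpenEdge λ′ p q = Adj₂ p q × Labeling.lab λ′ p q ≡ true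

module _ {A : Set} (_≈_ : A → A → Set) (E : A → A → Set) where

  -- consecutive pairs of the closed walk x₀ x₁ … x_{k-1} x₀
  consecPairs : List A → List (A × A)
  consecPairs []       = []
  consecPairs (x ∷ xs) = zip (x ∷ xs) (xs ++ [ x ])

  IsCycle : List A → Set
  IsCycle C = length C ≥ 3
            × AllPairs (λ a b → ¬ a ≈ b) C
            × All (λ ab → E (proj₁ ab) (proj₂ ab)) (consecPairs C)

  CycleEdge : List A → A → A → Set
  CycleEdge C u v =
    Any (λ ab → (u ≈ proj₁ ab × v ≈ proj₂ ab) ⊎ (u ≈ proj₂ ab × v ≈ proj₁ ab))
        (consecPairs C)

  Disjoint : List A → List A → Set
  Disjoint C D = ∀ v → Any (v ≈_) C → Any (v ≈_) D → ⊥

  DisjointUnionOfCycles : Set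
  DisjointUnionOfCycles =
    Σ[ Cs ∈ List (List A) ]
      (All IsCycle Cs
       × AllPairs Disjoint Cs
       × (∀ u v → E u v → Any (λ C → CycleEdge C u v) Cs))

{-# OPTIONS --safe #-}
module Submission where

-- A vertex p of 𝔏₂(G) is an edge {x, e} of L(G) and lies in exactly two reduced
-- cliques, 𝕏_x and 𝕏_e. Inside 𝕏_x, p has at most two neighbours: a neighbour {x, f}
-- with f meeting x where e does would lie, with p, on the triangle {x, e, f} of L(G)
-- and is deleted, while cubicity leaves only two choices of f at the other end of x.
-- A valid labeling then gives p exactly one open edge in each of its two cliques, so
-- the open subgraph is 2-regular. A finite 2-regular graph is a disjoint union of
-- cycles: a non-backtracking walk first repeats a vertex by returning to its start,
-- and the closed walk is a cycle containing every edge at each of its vertices.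

open import Defs
open import Data.Bool using (true; false; T; not)
open import Data.Bool.Properties using (not-¬)
open import Data.Empty using (⊥; ⊥-elim)
open import Data.Fin as Fin using (Fin; zero; suc; toℕ)
open import Data.Fin.Properties using (pigeonhole; _≟_)
open import Data.List using (List; []; _∷_; _++_; [_]; zip; length; lookup; applyUpTo; concatMap; allFin; filterᵇ)
open import Data.List.Properties using (length-applyUpTo)
open import Data.List.Membership.Propositional using (_∈_)
open import Data.List.Membership.Propositional.Properties using (∈-allFin; ∈-filter⁺)
open import Data.List.Relation.Unary.All as All using (All; []; _∷_)
import Data.List.Relation.Unary.All.Properties as All
open import Data.List.Relation.Unary.AllPairs using (AllPairs; []; _∷_)
import Data.List.Relation.Unary.AllPairs.Properties as AllPairs
open import Data.List.Relation.Unary.Any as Any using (Any; here; there)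
open import Data.List.Relation.Unary.Any.Properties using (lookup-index; applyUpTo⁺; applyUpTo⁻; concatMap⁺; ++⁺ˡ; ++⁺ʳ)
open import Data.Nat using (ℕ; zero; suc; _+_; _≤_; _<_; z≤n; s≤s; s≤s⁻¹; z<s; s<s)
open import Data.Nat.Induction using (<-rec)
open import Data.Nat.Properties using (anyUpTo?; ≤⇒≯; ≤-refl; <⇒≤; n≤1+n; ≤-antisym; ≮⇒≥; n<1+n; m≤n⇒m<n∨m≡n; <-cmp)
open import Data.Product using (Σ; Σ-syntax; _×_; _,_; proj₁; proj₂)
open import Data.Sum using (_⊎_; inj₁; inj₂)
open import Function using (_∘_)
open import Relation.Binary.Definitions using (Symmetric; Irreflexive; _Respectsʳ_; _Respectsˡ_; Decidable; tri<; tri≈; tri>)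
open import Relation.Binary.PropositionalEquality using (_≡_; _≢_; refl; sym; trans; subst; cong)
open import Relation.Binary.PropositionalEquality.Properties using () renaming (isDecEquivalence to ≡-isDecEquivalence)
open import Relation.Binary.Structures using (IsDecEquivalence)
open import Relation.Nullary using (¬_; Dec; yes; no)
open import Relation.Nullary.Decidable using (_⊎-dec_; _×-dec_; T?)

Minimal : (ℕ → Set) → ℕ → Set
Minimal P k = P k × (∀ {j} → j < k → ¬ P j)

least : ∀ {P : ℕ → Set} → (∀ n → Dec (P n)) → ∀ {n} → P n → Σ ℕ (Minimal P)
least {P} P? {n} = <-rec _ minimise n
  where
  minimise : ∀ n → (∀ {j} → j < n → P j → Σ ℕ (Minimal P)) → P n → Σ ℕ (Minimal P)
  minimise n smaller pn with anyUpTo? P? n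
  ... | yes (j , j<n , pj) = smaller j<n pj
  ... | no none = n , pn , λ j<n pj → none (_ , j<n , pj)

zip-applyUpTo : ∀ {A : Set} (f : ℕ → A) b m →
  zip (applyUpTo f (suc m)) (applyUpTo (f ∘ suc) m ++ [ b ]) ≡
  applyUpTo (λ i → f i , f (suc i)) m ++ [ f m , b ]
zip-applyUpTo f b zero = refl
zip-applyUpTo f b (suc m) = cong ((f 0 , f 1) ∷_) (zip-applyUpTo (f ∘ suc) b m)

All-lookup : ∀ {A : Set} {P : A → Set} {xs} → All P xs → ∀ i → P (lookup xs i)
All-lookup (p ∷ _) zero = p
All-lookup (_ ∷ ps) (suc i) = All-lookup ps i

AllPairs-lookup : ∀ {A : Set} {R : A → A → Set} {xs} → AllPairs R xs →
                  ∀ {i j} → i Fin.< j → R (lookup xs i) (lookup xs j)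
AllPairs-lookup (rs ∷ _) {zero} {suc j} _ = All-lookup rs j
AllPairs-lookup (_ ∷ rss) {suc i} {suc j} (s<s i<j) = AllPairs-lookup rss i<j

All∧Any : ∀ {A : Set} {P Q : A → Set} {xs} → All P xs → Any Q xs → Any (λ x → P x × Q x) xs
All∧Any (p ∷ _) (here q) = here (p , q)
All∧Any (_ ∷ ps) (there q) = there (All∧Any ps q)

complementary : ∀ {b b′} → b ≡ not b′ → b ≡ true ⊎ b′ ≡ true
complementary {true} _ = inj₁ refl
complementary {false} {true} _ = inj₂ refl

not-both-true : ∀ {b b′} → b ≡ not b′ → b ≡ true → b′ ≡ true → ⊥
not-both-true () refl refl

record IsSimpleGph (H : Gph) : Set where
  open Gph H
  field
    isDecEquivalence : IsDecEquivalence _≈_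
    Adj-sym          : Symmetric Adj
    Adj-respʳ        : Adj Respectsʳ _≈_
    Adj-irrefl       : Irreflexive _≈_ Adj

Enumerates : (H : Gph) → List (Gph.V H) → Set
Enumerates H xs = ∀ a → Any (Gph._≈_ H a) xs

module SimpleGphProperties {H : Gph} (simple : IsSimpleGph H) where
  open Gph H
  open IsSimpleGph simple
  open IsDecEquivalence isDecEquivalence
    renaming (refl to ≈-refl; sym to ≈-sym; trans to ≈-trans; _≟_ to _≈?_)

  Adj-respˡ : Adj Respectsˡ _≈_
  Adj-respˡ a≈a′ = Adj-sym ∘ Adj-respʳ a≈a′ ∘ Adj-sym

  SameEdge-refl : ∀ e → SameEdge H e e
  SameEdge-refl _ = inj₁ (≈-refl , ≈-refl)

  SameEdge-sym : ∀ e f → SameEdge H e f → SameEdge H f e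
  SameEdge-sym _ _ (inj₁ (s , t)) = inj₁ (≈-sym s , ≈-sym t)
  SameEdge-sym _ _ (inj₂ (s , t)) = inj₂ (≈-sym t , ≈-sym s)

  SameEdge-trans : ∀ e f g → SameEdge H e f → SameEdge H f g → SameEdge H e g
  SameEdge-trans _ _ _ (inj₁ (s , t)) (inj₁ (s′ , t′)) = inj₁ (≈-trans s s′ , ≈-trans t t′)
  SameEdge-trans _ _ _ (inj₁ (s , t)) (inj₂ (s′ , t′)) = inj₂ (≈-trans s s′ , ≈-trans t t′)
  SameEdge-trans _ _ _ (inj₂ (s , t)) (inj₁ (s′ , t′)) = inj₂ (≈-trans s t′ , ≈-trans t s′)
  SameEdge-trans _ _ _ (inj₂ (s , t)) (inj₂ (s′ , t′)) = inj₁ (≈-trans s t′ , ≈-trans t s′)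

  SameEdge? : Decidable (SameEdge H)
  SameEdge? e f = (src H e ≈? src H f ×-dec tgt H e ≈? tgt H f)
              ⊎-dec (src H e ≈? tgt H f ×-dec tgt H e ≈? src H f)

  SameEdge-isDecEquivalence : IsDecEquivalence (SameEdge H)
  SameEdge-isDecEquivalence = record
    { isEquivalence = record
      { refl  = λ {e} → SameEdge-refl e
      ; sym   = λ {e} {f} → SameEdge-sym e f
      ; trans = λ {e} {f} {g} → SameEdge-trans e f g
      }
    ; _≟_ = SameEdge?
    }

  Ends-resp : ∀ e {u w} → u ≈ w → Ends H e u → Ends H e w
  Ends-resp _ u≈w (inj₁ u≈s) = inj₁ (≈-trans (≈-sym u≈w) u≈s)
  Ends-resp _ u≈w (inj₂ u≈t) = inj₂ (≈-trans (≈-sym u≈w) u≈t)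

  SameEdge⇒Ends : ∀ e f {w} → SameEdge H e f → Ends H e w → Ends H f w
  SameEdge⇒Ends _ _ (inj₁ (s , _)) (inj₁ w≈s) = inj₁ (≈-trans w≈s s)
  SameEdge⇒Ends _ _ (inj₁ (_ , t)) (inj₂ w≈t) = inj₂ (≈-trans w≈t t)
  SameEdge⇒Ends _ _ (inj₂ (s , _)) (inj₁ w≈s) = inj₂ (≈-trans w≈s s)
  SameEdge⇒Ends _ _ (inj₂ (_ , t)) (inj₂ w≈t) = inj₁ (≈-trans w≈t t)

  Ends? : ∀ e w → Dec (Ends H e w)
  Ends? e w = (w ≈? src H e) ⊎-dec (w ≈? tgt H e)

  Ends-orient : ∀ e {c d} → Ends H e c → Ends H e d → ¬ c ≈ d →
                (src H e ≈ c × tgt H e ≈ d) ⊎ (src H e ≈ d × tgt H e ≈ c)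
  Ends-orient _ (inj₁ c≈s) (inj₁ d≈s) c≉d = ⊥-elim (c≉d (≈-trans c≈s (≈-sym d≈s)))
  Ends-orient _ (inj₁ c≈s) (inj₂ d≈t) _   = inj₁ (≈-sym c≈s , ≈-sym d≈t)
  Ends-orient _ (inj₂ c≈t) (inj₁ d≈s) _   = inj₂ (≈-sym d≈s , ≈-sym c≈t)
  Ends-orient _ (inj₂ c≈t) (inj₂ d≈t) c≉d = ⊥-elim (c≉d (≈-trans c≈t (≈-sym d≈t)))

  Ends-atMostTwo : ∀ e {c d u} → Ends H e c → Ends H e d → Ends H e u → ¬ c ≈ u → ¬ d ≈ u → c ≈ d
  Ends-atMostTwo e ec ed eu c≉u d≉u with Ends-orient e ec eu c≉u | Ends-orient e ed eu d≉u
  ... | inj₁ (s≈c , _) | inj₁ (s≈d , _) = ≈-trans (≈-sym s≈c) s≈d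
  ... | inj₁ (_ , t≈u) | inj₂ (_ , t≈d) = ⊥-elim (d≉u (≈-trans (≈-sym t≈d) t≈u))
  ... | inj₂ (s≈u , _) | inj₁ (s≈d , _) = ⊥-elim (d≉u (≈-trans (≈-sym s≈d) s≈u))
  ... | inj₂ (_ , t≈c) | inj₂ (_ , t≈d) = ≈-trans (≈-sym t≈c) t≈d

  common-Ends⇒SameEdge : ∀ e f {c d} → ¬ c ≈ d →
    Ends H e c → Ends H e d → Ends H f c → Ends H f d → SameEdge H e f
  common-Ends⇒SameEdge e f c≉d ec ed fc fd with Ends-orient e ec ed c≉d | Ends-orient f fc fd c≉d
  ... | inj₁ (s , t) | inj₁ (s′ , t′) = inj₁ (≈-trans s (≈-sym s′) , ≈-trans t (≈-sym t′))
  ... | inj₁ (s , t) | inj₂ (s′ , t′) = inj₂ (≈-trans s (≈-sym t′) , ≈-trans t (≈-sym s′))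
  ... | inj₂ (s , t) | inj₁ (s′ , t′) = inj₂ (≈-trans s (≈-sym t′) , ≈-trans t (≈-sym s′))
  ... | inj₂ (s , t) | inj₂ (s′ , t′) = inj₁ (≈-trans s (≈-sym s′) , ≈-trans t (≈-sym t′))

  Ends⇒Adj : ∀ e {c d} → Ends H e c → Ends H e d → ¬ c ≈ d → Adj c d
  Ends⇒Adj e ec ed c≉d with Ends-orient e ec ed c≉d
  ... | inj₁ (s≈c , t≈d) = Adj-respʳ t≈d (Adj-respˡ s≈c (proj₂ e))
  ... | inj₂ (s≈d , t≈c) = Adj-respʳ s≈d (Adj-respˡ t≈c (Adj-sym (proj₂ e)))

  opposite : V → Edge H → V
  opposite c e with c ≈? src H e
  ... | yes _ = tgt H e
  ... | no _  = src H e

  opposite-Ends : ∀ e c → Ends H e (opposite c e)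
  opposite-Ends e c with c ≈? src H e
  ... | yes _ = inj₂ ≈-refl
  ... | no _  = inj₁ ≈-refl

  opposite-≉ : ∀ e {c} → Ends H e c → ¬ opposite c e ≈ c
  opposite-≉ e {c} ec with c ≈? src H e | ec
  ... | yes c≈s | _        = λ t≈c → Adj-irrefl (≈-trans (≈-sym c≈s) (≈-sym t≈c)) (proj₂ e)
  ... | no c≉s  | inj₁ c≈s = ⊥-elim (c≉s c≈s)
  ... | no _    | inj₂ c≈t = λ s≈c → Adj-irrefl (≈-trans s≈c c≈t) (proj₂ e)

  Ends⇒≈-or-opposite : ∀ e {c w} → Ends H e c → Ends H e w → w ≈ c ⊎ w ≈ opposite c e
  Ends⇒≈-or-opposite e {c} {w} ec ew with w ≈? c
  ... | yes w≈c = inj₁ w≈c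
  ... | no w≉c  = inj₂ (Ends-atMostTwo e ew (opposite-Ends e c) ec w≉c (opposite-≉ e ec))

  ShareExactlyOne-sym : ∀ e f → ShareExactlyOne H e f → ShareExactlyOne H f e
  ShareExactlyOne-sym _ _ (w , ew , fw , unique) = w , fw , ew , λ w′ fw′ ew′ → unique w′ ew′ fw′

  ShareExactlyOne-respʳ : ∀ e f f′ → SameEdge H f f′ → ShareExactlyOne H e f → ShareExactlyOne H e f′
  ShareExactlyOne-respʳ e f f′ f≈f′ (w , ew , fw , unique) =
    w , ew , SameEdge⇒Ends f f′ f≈f′ fw ,
    λ w′ ew′ f′w′ → unique w′ ew′ (SameEdge⇒Ends f′ f (SameEdge-sym f f′ f≈f′) f′w′)

  ShareExactlyOne-both-Ends : ∀ e f → ShareExactlyOne H e f → Ends H f (src H e) → Ends H f (tgt H e) → ⊥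
  ShareExactlyOne-both-Ends e f (_ , _ , _ , unique) fs ft =
    Adj-irrefl (≈-trans (unique _ (inj₁ ≈-refl) fs) (≈-sym (unique _ (inj₂ ≈-refl) ft))) (proj₂ e)

  ShareExactlyOne⇒¬SameEdge : ∀ e f → ShareExactlyOne H e f → ¬ SameEdge H e f
  ShareExactlyOne⇒¬SameEdge e f share e≈f =
    ShareExactlyOne-both-Ends e f share
      (SameEdge⇒Ends e f e≈f (inj₁ ≈-refl)) (SameEdge⇒Ends e f e≈f (inj₂ ≈-refl))

  common-End⇒ShareExactlyOne : ∀ e f {c} → ¬ SameEdge H e f → Ends H e c → Ends H f c → ShareExactlyOne H e f
  common-End⇒ShareExactlyOne e f {c} e≉f ec fc = c , ec , fc , only-c
    where
    only-c : ∀ w → Ends H e w → Ends H f w → w ≈ c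
    only-c w ew fw with w ≈? c
    ... | yes w≈c = w≈c
    ... | no w≉c  = ⊥-elim (e≉f (common-Ends⇒SameEdge e f w≉c ew ec fw fc))

  ShareExactlyOne? : Decidable (ShareExactlyOne H)
  ShareExactlyOne? e f with SameEdge? e f
  ... | yes e≈f = no λ share → ShareExactlyOne⇒¬SameEdge e f share e≈f
  ... | no e≉f with Ends? f (src H e) | Ends? f (tgt H e)
  ...   | yes fs | _      = yes (common-End⇒ShareExactlyOne e f e≉f (inj₁ ≈-refl) fs)
  ...   | no _   | yes ft = yes (common-End⇒ShareExactlyOne e f e≉f (inj₂ ≈-refl) ft)
  ...   | no ¬fs | no ¬ft = no λ { (w , inj₁ w≈s , fw , _) → ¬fs (Ends-resp f w≈s fw)
                                 ; (w , inj₂ w≈t , fw , _) → ¬ft (Ends-resp f w≈t fw) }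

  Line-isSimple : IsSimpleGph (Line H)
  Line-isSimple = record
    { isDecEquivalence = SameEdge-isDecEquivalence
    ; Adj-sym          = λ {e} {f} → ShareExactlyOne-sym e f
    ; Adj-respʳ        = λ {e} {f} {f′} → ShareExactlyOne-respʳ e f f′
    ; Adj-irrefl       = λ {e} {f} e≈f share → ShareExactlyOne⇒¬SameEdge e f share e≈f
    }

  edgeIfAdj : Decidable Adj → V → V → List (Edge H)
  edgeIfAdj Adj? a b with Adj? a b
  ... | yes ab = [ (a , b) , ab ]
  ... | no _   = []

  edgesOver : Decidable Adj → List V → List (Edge H)
  edgesOver Adj? xs = concatMap (λ a → concatMap (edgeIfAdj Adj? a) xs) xs

  edgesOver-enumerates : ∀ Adj? {xs} → Enumerates H xs → Enumerates (Line H) (edgesOver Adj? xs)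
  edgesOver-enumerates Adj? enum ((a , b) , ab) =
    concatMap⁺ _ (Any.map (λ a≈a′ → concatMap⁺ _ (Any.map (found a≈a′) (enum b))) (enum a))
    where
    found : ∀ {a′ b′} → a ≈ a′ → b ≈ b′ → Any (SameEdge H ((a , b) , ab)) (edgeIfAdj Adj? a′ b′)
    found {a′} {b′} a≈a′ b≈b′ with Adj? a′ b′
    ... | yes _    = here (inj₁ (a≈a′ , b≈b′))
    ... | no ¬a′b′ = ⊥-elim (¬a′b′ (Adj-respʳ b≈b′ (Adj-respˡ a≈a′ ab)))

module TwoRegular
  {A : Set} {_≈_ : A → A → Set} (≈-isDecEquivalence : IsDecEquivalence _≈_)
  (E : A → A → Set) (E-sym : Symmetric E) (E-respʳ : E Respectsʳ _≈_) (E-irrefl : Irreflexive _≈_ E)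
  (nbr₁ nbr₂ : A → A) (E-nbr₁ : ∀ a → E a (nbr₁ a)) (E-nbr₂ : ∀ a → E a (nbr₂ a))
  (nbr₁≉nbr₂ : ∀ a → ¬ nbr₁ a ≈ nbr₂ a) (E⇒nbr : ∀ {a b} → E a b → b ≈ nbr₁ a ⊎ b ≈ nbr₂ a)
  (enum : List A) (enum-complete : ∀ a → Any (a ≈_) enum)
  where

  open IsDecEquivalence ≈-isDecEquivalence
    renaming (refl to ≈-refl; sym to ≈-sym; trans to ≈-trans; _≟_ to _≈?_)

  E-respˡ : E Respectsˡ _≈_
  E-respˡ a≈a′ = E-sym ∘ E-respʳ a≈a′ ∘ E-sym

  E-from-two : ∀ {a b c d} → E a b → E a c → ¬ b ≈ c → E a d → d ≈ b ⊎ d ≈ c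
  E-from-two ab ac b≉c ad with E⇒nbr ab | E⇒nbr ac | E⇒nbr ad
  ... | inj₁ b≈ | inj₁ c≈ | _       = ⊥-elim (b≉c (≈-trans b≈ (≈-sym c≈)))
  ... | inj₂ b≈ | inj₂ c≈ | _       = ⊥-elim (b≉c (≈-trans b≈ (≈-sym c≈)))
  ... | inj₁ b≈ | inj₂ _  | inj₁ d≈ = inj₁ (≈-trans d≈ (≈-sym b≈))
  ... | inj₁ _  | inj₂ c≈ | inj₂ d≈ = inj₂ (≈-trans d≈ (≈-sym c≈))
  ... | inj₂ _  | inj₁ c≈ | inj₁ d≈ = inj₂ (≈-trans d≈ (≈-sym c≈))
  ... | inj₂ b≈ | inj₁ _  | inj₂ d≈ = inj₁ (≈-trans d≈ (≈-sym b≈))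

  other : A → A → A
  other a b with b ≈? nbr₁ a
  ... | yes _ = nbr₂ a
  ... | no _  = nbr₁ a

  E-other : ∀ a b → E a (other a b)
  E-other a b with b ≈? nbr₁ a
  ... | yes _ = E-nbr₂ a
  ... | no _  = E-nbr₁ a

  other-≉ : ∀ a b → ¬ other a b ≈ b
  other-≉ a b with b ≈? nbr₁ a
  ... | yes b≈ = λ o≈b → nbr₁≉nbr₂ a (≈-sym (≈-trans o≈b b≈))
  ... | no b≉  = λ o≈b → b≉ (≈-sym o≈b)

  _∈≈_ : A → List A → Set
  a ∈≈ C = Any (a ≈_) C

  Closed : List A → Set
  Closed D = ∀ {a b} → a ∈≈ D → E a b → b ∈≈ D

  IsComponent : List A → Set
  IsComponent C = IsCycle _≈_ E C × (∀ {a b} → a ∈≈ C → E a b → CycleEdge _≈_ E C a b × b ∈≈ C)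

  CycleEdge-resp : ∀ {C a a′ b b′} → a ≈ a′ → b ≈ b′ → CycleEdge _≈_ E C a b → CycleEdge _≈_ E C a′ b′
  CycleEdge-resp a≈ b≈ = Any.map λ
    { (inj₁ (a≈s , b≈t)) → inj₁ (≈-trans (≈-sym a≈) a≈s , ≈-trans (≈-sym b≈) b≈t)
    ; (inj₂ (a≈t , b≈s)) → inj₂ (≈-trans (≈-sym a≈) a≈t , ≈-trans (≈-sym b≈) b≈s) }

  -- Indexing the last vertex as 2 + k builds in a length ≥ 3.
  module CycleFromPath (f : ℕ → A) (k : ℕ)
    (path : ∀ {i} → i < 2 + k → E (f i) (f (suc i)))
    (closing : E (f (2 + k)) (f 0))
    (distinct : ∀ {i j} → i < j → j ≤ 2 + k → ¬ f i ≈ f j) where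

    cycle : List A
    cycle = applyUpTo f (3 + k)

    pair : ℕ → A × A
    pair i = f i , f (suc i)

    consecPairs-cycle : consecPairs _≈_ E cycle ≡ applyUpTo pair (2 + k) ++ [ f (2 + k) , f 0 ]
    consecPairs-cycle = zip-applyUpTo f (f 0) (2 + k)

    pair∈ : ∀ {i} → i < 2 + k → pair i ∈ consecPairs _≈_ E cycle
    pair∈ {i} i<m = subst (pair i ∈_) (sym consecPairs-cycle) (++⁺ˡ (applyUpTo⁺ pair refl i<m))

    closing∈ : (f (2 + k) , f 0) ∈ consecPairs _≈_ E cycle
    closing∈ = subst ((f (2 + k) , f 0) ∈_) (sym consecPairs-cycle) (++⁺ʳ (applyUpTo pair (2 + k)) (here refl))

    forward : ∀ {s t} → (f s , f t) ∈ consecPairs _≈_ E cycle → CycleEdge _≈_ E cycle (f s) (f t)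
    forward = Any.map λ { refl → inj₁ (≈-refl , ≈-refl) }

    backward : ∀ {s t} → (f t , f s) ∈ consecPairs _≈_ E cycle → CycleEdge _≈_ E cycle (f s) (f t)
    backward = Any.map λ { refl → inj₂ (≈-refl , ≈-refl) }

    isCycle : IsCycle _≈_ E cycle
    isCycle =
      subst (3 ≤_) (sym (length-applyUpTo f (3 + k))) (s≤s (s≤s (s≤s z≤n))) ,
      AllPairs.applyUpTo⁺₁ f (3 + k) (λ i<j j<3+k → distinct i<j (s≤s⁻¹ j<3+k)) ,
      subst (All _) (sym consecPairs-cycle) (All.++⁺ (All.applyUpTo⁺₁ _ (2 + k) path) (closing ∷ []))

    record Flanks (s : ℕ) : Set where
      field
        before after : ℕ
        before≤ : before ≤ 2 + k
        after≤ : after ≤ 2 + k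
        before≉after : ¬ f before ≈ f after
        E-before : E (f s) (f before)
        E-after : E (f s) (f after)
        edge-before : CycleEdge _≈_ E cycle (f s) (f before)
        edge-after : CycleEdge _≈_ E cycle (f s) (f after)

    flanks : ∀ {s} → s ≤ 2 + k → Flanks s
    flanks {s} s≤m with m≤n⇒m<n∨m≡n s≤m
    flanks {zero} _ | inj₁ _ = record
      { before = 2 + k ; after = 1 ; before≤ = ≤-refl ; after≤ = s≤s z≤n
      ; before≉after = λ m≈1 → distinct (s≤s (s≤s z≤n)) ≤-refl (≈-sym m≈1)
      ; E-before = E-sym closing ; E-after = path z<s
      ; edge-before = backward closing∈ ; edge-after = forward (pair∈ z<s) }
    flanks {suc s} _ | inj₁ 1+s<m = record
      { before = s ; after = 2 + s ; before≤ = <⇒≤ (<⇒≤ 1+s<m) ; after≤ = 1+s<m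
      ; before≉after = distinct (s≤s (n≤1+n _)) 1+s<m
      ; E-before = E-sym (path (<⇒≤ 1+s<m)) ; E-after = path 1+s<m
      ; edge-before = backward (pair∈ (<⇒≤ 1+s<m)) ; edge-after = forward (pair∈ 1+s<m) }
    flanks _ | inj₂ refl = record
      { before = suc k ; after = 0 ; before≤ = n≤1+n _ ; after≤ = z≤n
      ; before≉after = λ k≈0 → distinct z<s (n≤1+n _) (≈-sym k≈0)
      ; E-before = E-sym (path ≤-refl) ; E-after = closing
      ; edge-before = backward (pair∈ ≤-refl) ; edge-after = forward closing∈ }

    isComponent : IsComponent cycle
    isComponent = isCycle , λ a∈ ab → at (applyUpTo⁻ f a∈) ab
      where
      at : ∀ {a b} → Σ[ s ∈ ℕ ] (s < 3 + k × a ≈ f s) → E a b → CycleEdge _≈_ E cycle a b × b ∈≈ cycle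
      at {a} {b} (s , s<3+k , a≈fs) ab = neighbour (E-from-two E-before E-after before≉after (E-respˡ a≈fs ab))
        where
        open Flanks (flanks (s≤s⁻¹ s<3+k))
        neighbour : b ≈ f before ⊎ b ≈ f after → CycleEdge _≈_ E cycle a b × b ∈≈ cycle
        neighbour (inj₁ b≈) =
          CycleEdge-resp {cycle} (≈-sym a≈fs) (≈-sym b≈) edge-before , applyUpTo⁺ f b≈ (s≤s before≤)
        neighbour (inj₂ b≈) =
          CycleEdge-resp {cycle} (≈-sym a≈fs) (≈-sym b≈) edge-after , applyUpTo⁺ f b≈ (s≤s after≤)

  position : A → Fin (length enum)
  position a = Any.index (enum-complete a)

  position-injective : ∀ {a b} → position a ≡ position b → a ≈ b
  position-injective {a} {b} same = ≈-trans (lookup-index (enum-complete a))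
    (≈-sym (subst (λ i → b ≈ lookup enum i) (sym same) (lookup-index (enum-complete b))))

  record CycleThrough (a : A) : Set where
    field
      cycle : List A
      component : IsComponent cycle
      start : a ∈≈ cycle
      reaches-start : ∀ {D} → Closed D → ∀ {v} → v ∈≈ cycle → v ∈≈ D → a ∈≈ D

  module Walk (a : A) where
    visit : ℕ → A × A
    visit zero = a , nbr₁ a
    visit (suc t) = proj₂ (visit t) , other (proj₂ (visit t)) (proj₁ (visit t))

    w : ℕ → A
    w t = proj₁ (visit t)

    w-step : ∀ t → E (w t) (w (suc t))
    w-step zero = E-nbr₁ a
    w-step (suc t) = E-other _ _

    w-nonbacktracking : ∀ t → ¬ w (2 + t) ≈ w t
    w-nonbacktracking t = other-≉ _ _

    Repeats : ℕ → Set
    Repeats j = Σ[ i ∈ ℕ ] (i < j × w i ≈ w j)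

    Repeats? : ∀ j → Dec (Repeats j)
    Repeats? j = anyUpTo? (λ i → w i ≈? w j) j

    some-repeat : Σ ℕ Repeats
    some-repeat with pigeonhole (n<1+n (length enum)) (position ∘ w ∘ toℕ)
    ... | i , j , i<j , same = toℕ j , toℕ i , i<j , position-injective same

    -- If i > 0, then w (j - 1) is a neighbour of w i, hence w (i - 1) or w (i + 1);
    -- either is an earlier repeat, a backtrack, or a loop.
    first-repeat-returns : ∀ {i j} → i < j → w i ≈ w j → (∀ {j′} → j′ < j → ¬ Repeats j′) → i ≡ 0
    first-repeat-returns {zero} _ _ _ = refl
    first-repeat-returns {suc i} {suc j} (s<s i<j) wi≈wj earlier
      with E-from-two (E-sym (w-step i)) (w-step (suc i)) (λ i≈ → w-nonbacktracking i (≈-sym i≈))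
                      (E-respˡ (≈-sym wi≈wj) (E-sym (w-step j)))
    ... | inj₁ wj≈wi = ⊥-elim (earlier (n<1+n j) (i , i<j , ≈-sym wj≈wi))
    ... | inj₂ wj≈w2+i with <-cmp (2 + i) j
    ...   | tri< 2+i<j _ _ = ⊥-elim (earlier (n<1+n j) (2 + i , 2+i<j , ≈-sym wj≈w2+i))
    ...   | tri≈ _ refl _ = ⊥-elim (w-nonbacktracking (suc i) (≈-sym wi≈wj))
    ...   | tri> _ _ j<2+i with ≤-antisym (s≤s⁻¹ j<2+i) i<j
    ...     | refl = ⊥-elim (E-irrefl wj≈w2+i (w-step (suc i)))

    walk-back : ∀ {D} → Closed D → ∀ s → w s ∈≈ D → a ∈≈ D
    walk-back closed zero a∈ = a∈
    walk-back closed (suc s) ws∈ = walk-back closed s (closed ws∈ (E-sym (w-step s)))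

    closed-cycle : ∀ {j} → 0 < j → w 0 ≈ w j → (∀ {j′} → j′ < j → ¬ Repeats j′) → CycleThrough a
    closed-cycle {1} _ w0≈w1 _ = ⊥-elim (E-irrefl w0≈w1 (w-step 0))
    closed-cycle {2} _ w0≈w2 _ = ⊥-elim (w-nonbacktracking 0 (≈-sym w0≈w2))
    closed-cycle {suc (suc (suc k))} _ w0≈wj earlier = record
      { cycle = cycle
      ; component = isComponent
      ; start = here ≈-refl
      ; reaches-start = λ closed v∈ v∈D →
          let (s , _ , v≈ws) = applyUpTo⁻ w v∈ in walk-back closed s (Any.map (≈-trans (≈-sym v≈ws)) v∈D)
      }
      where
      open CycleFromPath w k (λ {i} _ → w-step i) (E-respʳ (≈-sym w0≈wj) (w-step (2 + k)))
                             (λ i<i′ i′≤ wi≈ → earlier (s≤s i′≤) (_ , i<i′ , wi≈))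

    cycleThrough : CycleThrough a
    cycleThrough with least Repeats? (proj₂ some-repeat)
    ... | j , (i , i<j , wi≈wj) , earlier with first-repeat-returns i<j wi≈wj earlier
    ...   | refl = closed-cycle i<j wi≈wj earlier

  Covering : List A → Set
  Covering xs = Σ[ Cs ∈ List (List A) ]
    (All IsComponent Cs × AllPairs (Disjoint _≈_ E) Cs × (∀ {a} → a ∈≈ xs → Any (a ∈≈_) Cs))

  fresh-disjoint : ∀ {a} (through : CycleThrough a) {Cs} → All IsComponent Cs → ¬ Any (a ∈≈_) Cs →
                   All (Disjoint _≈_ E (CycleThrough.cycle through)) Cs
  fresh-disjoint through [] _ = []
  fresh-disjoint through ((_ , edges) ∷ comps) a∉ =
    (λ v v∈C v∈D → a∉ (here (reaches-start (λ a∈ ab → proj₂ (edges a∈ ab)) v∈C v∈D)))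
    ∷ fresh-disjoint through comps (a∉ ∘ there)
    where open CycleThrough through

  cover : ∀ xs → Covering xs
  cover [] = [] , [] , [] , λ ()
  cover (x ∷ xs) with cover xs
  ... | Cs , comps , disjoint , covered with Any.any? (λ C → Any.any? (x ≈?_) C) Cs
  ...   | yes x∈Cs = Cs , comps , disjoint , λ
          { (here a≈x) → Any.map (Any.map (≈-trans a≈x)) x∈Cs
          ; (there a∈) → covered a∈ }
  ...   | no x∉Cs = cycle ∷ Cs , component ∷ comps , fresh-disjoint through comps x∉Cs ∷ disjoint , λ
          { (here a≈x) → here (Any.map (≈-trans a≈x) start)
          ; (there a∈) → there (covered a∈) }
    where
    through : CycleThrough x
    through = Walk.cycleThrough x
    open CycleThrough through

  decomposition : DisjointUnionOfCycles _≈_ E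
  decomposition with cover enum
  ... | Cs , comps , disjoint , covered =
    Cs , All.map proj₁ comps , disjoint ,
    λ u v uv → Any.map (λ { ((_ , edges) , u∈C) → proj₁ (edges u∈C uv) })
                       (All∧Any comps (covered (enum-complete u)))

module LineGraphsOf {n : ℕ} (G : SimpleGraph n) where
  open SimpleGraph G using (adj)

  toGph-isSimple : IsSimpleGph (toGph G)
  toGph-isSimple = record
    { isDecEquivalence = ≡-isDecEquivalence _≟_
    ; Adj-sym          = λ {a} {b} → subst T (SimpleGraph.sym G a b)
    ; Adj-respʳ        = λ { refl ab → ab }
    ; Adj-irrefl       = λ { {a} refl aa → subst T (SimpleGraph.irrefl G a) aa }
    }

  module P₀ = SimpleGphProperties toGph-isSimple

  LG-isSimple : IsSimpleGph (LG G)
  LG-isSimple = P₀.Line-isSimple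

  module P₁ = SimpleGphProperties LG-isSimple

  _≈₁_ : V₁ G → V₁ G → Set
  _≈₁_ = Gph._≈_ (LG G)

  Ends₀ : V₁ G → Fin n → Set
  Ends₀ = Ends (toGph G)

  Deleted-sym : ∀ p q → Deleted G p q → Deleted G q p
  Deleted-sym _ _ (x , y , z , xyz , p∈ , q∈) = x , y , z , xyz , q∈ , p∈

  Deleted-respʳ : ∀ p q q′ → _≈₂_ G q q′ → Deleted G p q′ → Deleted G p q
  Deleted-respʳ _ q q′ q≈q′ (x , y , z , xyz , p∈ , q′∈) =
    x , y , z , xyz , p∈ , λ w qw → q′∈ w (P₁.SameEdge⇒Ends q q′ {w} q≈q′ qw)

  Adj₂-sym : ∀ p q → Adj₂ G p q → Adj₂ G q p
  Adj₂-sym p q (share , ¬deleted) = P₁.ShareExactlyOne-sym p q share , ¬deleted ∘ Deleted-sym q p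

  Adj₂-respʳ : ∀ p q q′ → _≈₂_ G q q′ → Adj₂ G p q → Adj₂ G p q′
  Adj₂-respʳ p q q′ q≈q′ (share , ¬deleted) =
    P₁.ShareExactlyOne-respʳ p q q′ q≈q′ share ,
    ¬deleted ∘ Deleted-respʳ p q q′ q≈q′

  Adj₂⇒≉ : ∀ p q → Adj₂ G p q → ¬ _≈₂_ G p q
  Adj₂⇒≉ p q (share , _) = P₁.ShareExactlyOne⇒¬SameEdge p q share

  neighbours-bound : ∀ v {k} (g : Fin k → Fin n) → (∀ i → GAdj G v (g i)) →
                     (∀ {i j} → i Fin.< j → g i ≢ g j) → k ≤ degree G v
  neighbours-bound v {k} g adjacent distinct = ≮⇒≥ λ deg<k →
    let (i , j , i<j , same) = pigeonhole deg<k index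
    in distinct i<j (trans (lookup-index (member i))
                           (trans (cong (lookup neighbours) same) (sym (lookup-index (member j)))))
    where
    neighbours : List (Fin n)
    neighbours = filterᵇ (adj v) (allFin n)
    member : ∀ i → g i ∈ neighbours
    member i = ∈-filter⁺ (T? ∘ adj v) (∈-allFin (g i)) (adjacent i)
    index : Fin k → Fin (degree G v)
    index i = Any.index (member i)

  edges-at-bound : ∀ c {k} (g : Fin k → V₁ G) → (∀ i → Ends₀ (g i) c) →
                   (∀ {i j} → i Fin.< j → ¬ g i ≈₁ g j) → k ≤ degree G c
  edges-at-bound c {k} g at-c distinct = neighbours-bound c far adjacent far-distinct
    where
    far : Fin k → Fin n
    far i = P₀.opposite c (g i)
    c≢far : ∀ i → c ≢ far i
    c≢far i c≡ = P₀.opposite-≉ (g i) (at-c i) (sym c≡)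
    adjacent : ∀ i → GAdj G c (far i)
    adjacent i = P₀.Ends⇒Adj (g i) (at-c i) (P₀.opposite-Ends (g i) c) (c≢far i)
    far-distinct : ∀ {i j} → i Fin.< j → far i ≢ far j
    far-distinct {i} {j} i<j same = distinct i<j
      (P₀.common-Ends⇒SameEdge (g i) (g j) (c≢far i) (at-c i) (P₀.opposite-Ends (g i) c)
        (at-c j) (subst (Ends₀ (g j)) (sym same) (P₀.opposite-Ends (g j) c)))

  partner : V₁ G → V₂ G → V₁ G
  partner x q = P₁.opposite x q

  partner-adj : ∀ x q → InX G x q → ShareExactlyOne (toGph G) x (partner x q)
  partner-adj x q xq = P₁.Ends⇒Adj q {x} {partner x q} xq (P₁.opposite-Ends q x)
    (λ x≈ → P₁.opposite-≉ q xq (P₀.SameEdge-sym x (partner x q) x≈))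

  same-partner : ∀ x q q′ → InX G x q → InX G x q′ → partner x q ≈₁ partner x q′ → _≈₂_ G q q′
  same-partner x q q′ xq xq′ e≈e′ =
    P₁.common-Ends⇒SameEdge q q′ {x} {partner x q}
      (P₀.ShareExactlyOne⇒¬SameEdge x (partner x q) (partner-adj x q xq))
      xq (P₁.opposite-Ends q x)
      xq′ (P₁.Ends-resp q′ {partner x q′} {partner x q}
             (P₀.SameEdge-sym (partner x q) (partner x q′) e≈e′) (P₁.opposite-Ends q′ x))

  pivot : ∀ x q → InX G x q → Fin n
  pivot x q xq = proj₁ (partner-adj x q xq)

  pivot-Ends : ∀ x q (xq : InX G x q) → Ends₀ x (pivot x q xq) × Ends₀ (partner x q) (pivot x q xq)
  pivot-Ends x q xq = let (_ , xc , ec , _) = partner-adj x q xq in xc , ec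

  partners-disjoint : ∀ x p q (xp : InX G x p) (xq : InX G x q) → Adj₂ G p q →
                      ∀ {c} → Ends₀ (partner x p) c → Ends₀ (partner x q) c → ⊥
  partners-disjoint x p q xp xq (share , ¬deleted) ec fc =
    ¬deleted (x , e , f , (partner-adj x p xp , e~f , partner-adj x q xq) , p-in , q-in)
    where
    e f : V₁ G
    e = partner x p
    f = partner x q
    e~f : ShareExactlyOne (toGph G) e f
    e~f = P₀.common-End⇒ShareExactlyOne e f
      (λ e≈f → P₁.ShareExactlyOne⇒¬SameEdge p q share (same-partner x p q xp xq e≈f)) ec fc
    p-in : InTriangle (LG G) x e f p
    p-in w pw with P₁.Ends⇒≈-or-opposite p {x} {w} xp pw
    ... | inj₁ w≈x = inj₁ w≈x
    ... | inj₂ w≈e = inj₂ (inj₁ w≈e)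
    q-in : InTriangle (LG G) x e f q
    q-in w qw with P₁.Ends⇒≈-or-opposite q {x} {w} xq qw
    ... | inj₁ w≈x = inj₁ w≈x
    ... | inj₂ w≈f = inj₂ (inj₂ w≈f)

  adjacent-pivots-differ : ∀ x p q (xp : InX G x p) (xq : InX G x q) → Adj₂ G p q → pivot x p xp ≢ pivot x q xq
  adjacent-pivots-differ x p q xp xq pq same = partners-disjoint x p q xp xq pq
    (proj₂ (pivot-Ends x p xp)) (subst (Ends₀ (partner x q)) (sym same) (proj₂ (pivot-Ends x q xq)))

  clique-degree≤2 : Cubic G → ∀ x p q₁ q₂ q₃ → EdgeX G x p q₁ → EdgeX G x p q₂ → EdgeX G x p q₃ →
                    ¬ _≈₂_ G q₁ q₂ → ¬ _≈₂_ G q₁ q₃ → ¬ _≈₂_ G q₂ q₃ → ⊥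
  clique-degree≤2 cubic x p q₁ q₂ q₃ (xp , xq₁ , pq₁) (_ , xq₂ , pq₂) (_ , xq₃ , pq₃) q₁≉q₂ q₁≉q₃ q₂≉q₃ =
    ≤⇒≯ (subst (4 ≤_) (cubic c) (edges-at-bound c (lookup edges) (All-lookup at-c) (AllPairs-lookup distinct)))
        (n<1+n 3)
    where
    c : Fin n
    c = pivot x q₁ xq₁
    differs : ∀ q (xq : InX G x q) → Adj₂ G p q → pivot x q xq ≢ pivot x p xp
    differs q xq pq same = adjacent-pivots-differ x p q xp xq pq (sym same)
    partner-at-c : ∀ q (xq : InX G x q) → Adj₂ G p q → Ends₀ (partner x q) c
    partner-at-c q xq pq = subst (Ends₀ (partner x q))
      (P₀.Ends-atMostTwo x (proj₁ (pivot-Ends x q xq)) (proj₁ (pivot-Ends x q₁ xq₁))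
        (proj₁ (pivot-Ends x p xp)) (differs q xq pq) (differs q₁ xq₁ pq₁))
      (proj₂ (pivot-Ends x q xq))
    edges : List (V₁ G)
    edges = x ∷ partner x q₁ ∷ partner x q₂ ∷ partner x q₃ ∷ []
    at-c : All (λ e → Ends₀ e c) edges
    at-c = proj₁ (pivot-Ends x q₁ xq₁)
         ∷ partner-at-c q₁ xq₁ pq₁ ∷ partner-at-c q₂ xq₂ pq₂ ∷ partner-at-c q₃ xq₃ pq₃ ∷ []
    x≉partner : ∀ q (xq : InX G x q) → ¬ x ≈₁ partner x q
    x≉partner q xq = P₀.ShareExactlyOne⇒¬SameEdge x (partner x q) (partner-adj x q xq)
    distinct : AllPairs (λ e f → ¬ e ≈₁ f) edges
    distinct = (x≉partner q₁ xq₁ ∷ x≉partner q₂ xq₂ ∷ x≉partner q₃ xq₃ ∷ [])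
             ∷ (q₁≉q₂ ∘ same-partner x q₁ q₂ xq₁ xq₂ ∷ q₁≉q₃ ∘ same-partner x q₁ q₃ xq₁ xq₃ ∷ [])
             ∷ (q₂≉q₃ ∘ same-partner x q₂ q₃ xq₂ xq₃ ∷ [])
             ∷ [] ∷ []

  V₂-list : List (V₂ G)
  V₂-list = P₁.edgesOver P₀.ShareExactlyOne? (P₀.edgesOver (λ a b → T? (adj a b)) (allFin n))

  V₂-enumerated : Enumerates (LLG G) V₂-list
  V₂-enumerated = P₁.edgesOver-enumerates P₀.ShareExactlyOne? (P₀.edgesOver-enumerates _ ∈-allFin)

module OpenEdges {n : ℕ} (G : SimpleGraph n) (cubic : Cubic G) (λ′ : Labeling G) (valid : Valid G λ′) where
  open LineGraphsOf G
  open Labeling λ′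

  ≈₂-isDecEquivalence : IsDecEquivalence (_≈₂_ G)
  ≈₂-isDecEquivalence = P₁.SameEdge-isDecEquivalence

  open IsDecEquivalence ≈₂-isDecEquivalence using () renaming (_≟_ to _≈₂?_)

  lab-respʳ : ∀ p q q′ → Adj₂ G p q → _≈₂_ G q q′ → lab p q ≡ lab p q′
  lab-respʳ p q q′ pq q≈q′ = lab-rep p q p q′ pq (P₁.SameEdge-refl p) q≈q′

  OpenAt : V₁ G → V₂ G → V₂ G → Set
  OpenAt x p q = EdgeX G x p q × lab p q ≡ true

  open-transfer : ∀ x p q r → OpenAt x p q → _≈₂_ G q r → lab p r ≡ true
  open-transfer _ p q r ((_ , _ , pq) , q-open) q≈r = trans (sym (lab-respʳ p q r pq q≈r)) q-open

  among-two : ∀ x p w u q → EdgeX G x p w → EdgeX G x p u → ¬ _≈₂_ G w u → EdgeX G x p q →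
              _≈₂_ G q w ⊎ _≈₂_ G q u
  among-two x p w u q pw pu w≉u pq with q ≈₂? w | q ≈₂? u
  ... | yes q≈w | _       = inj₁ q≈w
  ... | no _    | yes q≈u = inj₂ q≈u
  ... | no q≉w  | no q≉u  =
    ⊥-elim (clique-degree≤2 cubic x p w u q pw pu pq w≉u
              (q≉w ∘ P₁.SameEdge-sym w q) (q≉u ∘ P₁.SameEdge-sym u q))

  open-exists : ∀ x p → InX G x p → Σ[ q ∈ V₂ G ] OpenAt x p q
  open-exists x p xp with valid x p xp
  ... | w , u , _ , _ , pw , pu , w∓u with complementary w∓u
  ...   | inj₁ w-open = w , pw , w-open
  ...   | inj₂ u-open = u , pu , u-open

  open-unique : ∀ x p q q′ → OpenAt x p q → OpenAt x p q′ → _≈₂_ G q q′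
  open-unique x p q q′ q-open@(pq , _) q′-open@(pq′ , _) with valid x p (proj₁ pq)
  ... | w , u , _ , _ , pw , pu , w∓u =
    agree (among-two x p w u q pw pu w≉u pq) (among-two x p w u q′ pw pu w≉u pq′)
    where
    w≉u : ¬ _≈₂_ G w u
    w≉u w≈u = not-¬ (lab-respʳ p w u (proj₂ (proj₂ pw)) w≈u) w∓u
    agree : _≈₂_ G q w ⊎ _≈₂_ G q u → _≈₂_ G q′ w ⊎ _≈₂_ G q′ u → _≈₂_ G q q′
    agree (inj₁ q≈w) (inj₁ q′≈w) = P₁.SameEdge-trans q w q′ q≈w (P₁.SameEdge-sym q′ w q′≈w)
    agree (inj₂ q≈u) (inj₂ q′≈u) = P₁.SameEdge-trans q u q′ q≈u (P₁.SameEdge-sym q′ u q′≈u)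
    agree (inj₁ q≈w) (inj₂ q′≈u) =
      ⊥-elim (not-both-true w∓u (open-transfer x p q w q-open q≈w) (open-transfer x p q′ u q′-open q′≈u))
    agree (inj₂ q≈u) (inj₁ q′≈w) =
      ⊥-elim (not-both-true w∓u (open-transfer x p q′ w q′-open q′≈w) (open-transfer x p q u q-open q≈u))

  open-at-src : ∀ p → Σ[ q ∈ V₂ G ] OpenAt (src (LG G) p) p q
  open-at-src p = open-exists (src (LG G) p) p (inj₁ (P₀.SameEdge-refl (src (LG G) p)))

  open-at-tgt : ∀ p → Σ[ q ∈ V₂ G ] OpenAt (tgt (LG G) p) p q
  open-at-tgt p = open-exists (tgt (LG G) p) p (inj₂ (P₀.SameEdge-refl (tgt (LG G) p)))

  nbr₁ nbr₂ : V₂ G → V₂ G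
  nbr₁ p = proj₁ (open-at-src p)
  nbr₂ p = proj₁ (open-at-tgt p)

  open-nbr₁ : ∀ p → OpenEdge G λ′ p (nbr₁ p)
  open-nbr₁ p = let (_ , (_ , _ , pq) , q-open) = open-at-src p in pq , q-open

  open-nbr₂ : ∀ p → OpenEdge G λ′ p (nbr₂ p)
  open-nbr₂ p = let (_ , (_ , _ , pq) , q-open) = open-at-tgt p in pq , q-open

  nbr₁≉nbr₂ : ∀ p → ¬ _≈₂_ G (nbr₁ p) (nbr₂ p)
  nbr₁≉nbr₂ p with open-at-src p | open-at-tgt p
  ... | q , (_ , q∋s , (share , _)) , _ | r , (_ , r∋t , _) , _ = λ q≈r →
    P₁.ShareExactlyOne-both-Ends p q share q∋s
      (P₁.SameEdge⇒Ends r q {tgt (LG G) p} (P₁.SameEdge-sym q r q≈r) r∋t)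

  open⇒nbr : ∀ {p q} → OpenEdge G λ′ p q → _≈₂_ G q (nbr₁ p) ⊎ _≈₂_ G q (nbr₂ p)
  open⇒nbr {p} {q} (pq@(share , _) , q-open) with share
  ... | y , inj₁ y≈s , qy , _ = inj₁ (open-unique (src (LG G) p) p q (nbr₁ p)
          ((inj₁ (P₀.SameEdge-refl (src (LG G) p)) , P₁.Ends-resp q {y} {src (LG G) p} y≈s qy , pq) , q-open)
          (proj₂ (open-at-src p)))
  ... | y , inj₂ y≈t , qy , _ = inj₂ (open-unique (tgt (LG G) p) p q (nbr₂ p)
          ((inj₂ (P₀.SameEdge-refl (tgt (LG G) p)) , P₁.Ends-resp q {y} {tgt (LG G) p} y≈t qy , pq) , q-open)
          (proj₂ (open-at-tgt p)))

  OpenEdge-sym : Symmetric (OpenEdge G λ′)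
  OpenEdge-sym {p} {q} (pq , q-open) = Adj₂-sym p q pq , trans (sym (lab-sym p q pq)) q-open

  OpenEdge-respʳ : OpenEdge G λ′ Respectsʳ _≈₂_ G
  OpenEdge-respʳ {p} {q} {q′} q≈q′ (pq , q-open) =
    Adj₂-respʳ p q q′ q≈q′ pq , trans (sym (lab-respʳ p q q′ pq q≈q′)) q-open

  OpenEdge-irrefl : Irreflexive (_≈₂_ G) (OpenEdge G λ′)
  OpenEdge-irrefl {p} {q} p≈q (pq , _) = Adj₂⇒≉ p q pq p≈q

lemma2p4 : ∀ {n : ℕ} (G : SimpleGraph n) → Connected G → Bridgeless G → TriangleFree G → Cubic G → (λ′ : Labeling G) → Valid G λ′ → DisjointUnionOfCycles (_≈₂_ G) (OpenEdge G λ′)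
lemma2p4 G _ _ _ cubic λ′ valid =
  TwoRegular.decomposition ≈₂-isDecEquivalence (OpenEdge G λ′) OpenEdge-sym OpenEdge-respʳ OpenEdge-irrefl
    nbr₁ nbr₂ open-nbr₁ open-nbr₂ nbr₁≉nbr₂ open⇒nbr V₂-list V₂-enumerated
  where
  open LineGraphsOf G using (V₂-list; V₂-enumerated)
  open OpenEdges G cubic λ′ valid
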